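{- Let $\mathcal{G}$ be a finite DAG, $f\colon V(\mathcal{G})\to\mathbb{R}$, and let $M\colon S\to T$ be a max-weight, min-cardinality matching in $\mathrm{TC}(\mathcal{G})$. Let $(S_i:i\in[k])$ and $(T_i:i\in[k])$ be partitions of $S$ and $T$ with $M(S_i)=T_i$ for all $i$, such that the sets $V(\mathcal{H}(S_i,T_i))$, $i\in[k]$, are pairwise disjoint, and such that for all $i\in[k]$ and $(x,y)\in S_i\times T_i$ with $x\prec y$ there exists a matching $\widehat M\colon S_i\to T_i$ in $\mathrm{TC}(\mathcal{G})$ containing $(x,y)$. Then for all $i\in[k]$ and $(x,y)\in S_i\times T_i$, if $x\prec y$ then $f(x)>f(y)$.
   Context: For a DAG $\mathcal{G}$, $x\preceq y$ iff there is a directed path from $x$ to $y$; $x\prec y$ means $x\preceq y$, $x\ne y$. $\mathrm{TC}(\mathcal{G})$ is the graph on $V(\mathcal{G})$ with edges $\{(x,y):x\prec y\}$. A matching $M\colon S\to T$ in $\mathrm{TC}(\mathcal{G})$ is a bijection between disjoint sets $S,T\subseteq V(\mathcal{G})$ with $s\prec M(s)$ for all $s$, identified with the set of pairs $\{(s,M(s))\}$; $M(S')=\{M(s):s\in S'\}$. $M$ is max-weight, min-cardinality if it maximizes $\sum_{(x,y)\in M}(f(x)-f(y))$ over all matchings in $\mathrm{TC}(\mathcal{G})$ and, among those, minimizes $|M|$. $\mathcal{H}(s,t)$ is the union of all directed paths from $s$ to $t$ in $\mathcal{G}$, and $\mathcal{H}(S',T')=\bigcup_{(s,t)\in S'\times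 T'}\mathcal{H}(s,t)$. (In the paper the partitions are those produced by the matching decomposition lemma applied to $M$, which guarantees exactly the stated hypotheses.) -}

module Defs where

open import Level using (0ℓ)
open import Data.Nat as ℕ using (ℕ)
open import Data.Fin using (Fin)
open import Data.Product using (_×_; _,_; proj₁; proj₂; Σ; ∃)
open import Data.List using (List; map; _++_; length; foldr)
open import Data.List.Relation.Unary.All using (All)
open import Data.List.Membership.Propositional using (_∈_)
open import Data.List.Relation.Unary.Unique.Propositional using (Unique)
open import Relation.Binary.PropositionalEquality using (_≡_; _≢_)
open import Relation.Binary.Core using (Rel)
open import Relation.Binary.Structures using (IsTotalOrder)
open import Relation.Binary.Construct.Closure.Transitive using (TransClosure)
open import Relation.Binary.Construct.Closure.ReflexiveTransitive using (Star)
open import Relation.Nullary using (¬_)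
open import Algebra.Structures using (IsAbelianGroup)

-- Weights: a totally ordered abelian group (ℝ with +, 0, -, ≤ is an
-- instance; the standard library has no real numbers).

record OrderedAbelianGroup : Set₁ where
  field
    Carrier : Set
    _+_     : Carrier → Carrier → Carrier
    0#      : Carrier
    -_      : Carrier → Carrier
    _≤_     : Carrier → Carrier → Set
    isAbelianGroup : IsAbelianGroup _≡_ _+_ 0# -_
    isTotalOrder   : IsTotalOrder _≡_ _≤_
    +-monoˡ-≤      : ∀ {x y} z → x ≤ y → (x + z) ≤ (y + z)

  _<_ : Carrier → Carrier → Set
  x < y = (x ≤ y) × (x ≢ y)

  _-_ : Carrier → Carrier → Carrier
  x - y = x + (- y)

Graph : ℕ → Set₁
Graph n = Rel (Fin n) 0ℓ

module _ {n : ℕ} (E : Graph n) where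

  _≺_ : Rel (Fin n) 0ℓ
  _≺_ = TransClosure E

  _≼_ : Rel (Fin n) 0ℓ
  _≼_ = Star E

  IsDAG : Set
  IsDAG = ∀ x → ¬ (x ≺ x)

  -- A matching in TC(G), given as the list of its pairs (s , M s).
  -- Sources are the first components, targets the second; all sources
  -- and targets are pairwise distinct (so S ∩ T = ∅ and M is a
  -- bijection S → T), and s ≺ M(s) for every pair.
  sources : List (Fin n × Fin n) → List (Fin n)
  sources = map proj₁

  targets : List (Fin n × Fin n) → List (Fin n)
  targets = map proj₂

  IsMatching : List (Fin n × Fin n) → Set
  IsMatching M = All (λ p → proj₁ p ≺ proj₂ p) M × Unique (sources M ++ targets M)

  -- v is a vertex of H(s,t), the union of all directed s–t paths
  InH : Fin n → Fin n → Fin n → Set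
  InH s t v = (s ≼ v) × (v ≼ t)

module _ (W : OrderedAbelianGroup) where
  open OrderedAbelianGroup W

  weight : {n : ℕ} → (Fin n → Carrier) → List (Fin n × Fin n) → Carrier
  weight f = foldr (λ p acc → (f (proj₁ p) - f (proj₂ p)) + acc) 0#

  IsMaxWeightMinCard : {n : ℕ} → Graph n → (Fin n → Carrier) → List (Fin n × Fin n) → Set
  IsMaxWeightMinCard E f M =
    IsMatching E M ×
    (∀ N → IsMatching E N → weight f N ≤ weight f M) ×
    (∀ N → IsMatching E N → weight f N ≡ weight f M → length M ℕ.≤ length N)

module Submission where

-- Let N be a matching of S_i onto T_i that contains (x , y).  Replacing the block-i part
-- of M by N without (x , y) gives a matching M′ with one pair fewer and weight
-- w(M) − (f x − f y): the weight of a matching is Σ_S f − Σ_T f, so it depends only on the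
-- sets of sources and targets, and the block-i part of M has the same ones as N.
-- Maximality of w(M) gives f y ≤ f x, and minimality of |M| excludes equality.

open import Defs
open import Level using (0ℓ)
open import Data.Nat using (ℕ; suc)
import Data.Nat as ℕ
import Data.Nat.Properties as ℕₚ
open import Data.Fin using (Fin; _≟_)
open import Data.Product using (Σ; _×_; _,_; proj₁; proj₂)
open import Data.Sum using (inj₁; inj₂)
open import Data.Empty using (⊥)
open import Data.List using (List; []; _∷_; _++_; map; filter; foldr; length)
open import Data.List.Properties using (map-++; ++-assoc; length-++; length-map; partition-defn)
import Data.List.Relation.Unary.All.Properties as All
open import Data.List.Relation.Unary.AllPairs using (_∷_)
open import Data.List.Relation.Unary.Unique.Propositional using (Unique)
import Data.List.Relation.Unary.Unique.Propositional.Properties as Unique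
open import Data.List.Membership.Propositional using (_∈_)
open import Data.List.Membership.Propositional.Properties
  using (∈-map⁺; ∈-map⁻; ∈-filter⁺; ∈-filter⁻; ∈-++⁻; ∈-∃++)
open import Data.List.Membership.Propositional.Properties.WithK using (unique∧set⇒bag)
open import Data.List.Relation.Binary.BagAndSetEquality using (∼bag⇒↭)
open import Data.List.Relation.Binary.Sublist.Propositional
  using (_⊆_; []; _∷_; _∷ʳ_; ⊆-refl)
open import Data.List.Relation.Binary.Sublist.Propositional.Properties
  using (All-resp-⊆; Any-resp-⊆; filter-⊆)
  renaming (map⁺ to map⁺-⊆; ++⁺ to ++⁺-⊆; ++⁺ˡ to ++⁺ˡ-⊆; ++⁺ʳ to ++⁺ʳ-⊆)
open import Data.List.Relation.Binary.Permutation.Propositional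
  using (_↭_; ↭-sym; ↭⇒↭ₛ; ↭ₛ⇒↭; module PermutationReasoning)
open import Data.List.Relation.Binary.Permutation.Propositional.Properties
  using (shift; shifts; ↭-length; ++⁺ˡ) renaming (map⁺ to map⁺-↭)
import Data.List.Relation.Binary.Permutation.Setoid.Properties as Permₛ
open import Relation.Binary.PropositionalEquality
  using (_≡_; _≢_; refl; sym; trans; cong; cong₂; subst; subst₂; setoid; module ≡-Reasoning)
open import Relation.Nullary using (¬_)
open import Relation.Unary using (Pred; Decidable)
open import Relation.Unary.Properties using (∁?)
open import Function using (_∘_)
open import Function.Bundles using (_⇔_; mk⇔; Equivalence)
open import Function.Construct.Symmetry using (⇔-sym)
open import Function.Construct.Composition using (_⇔-∘_)
open import Algebra.Structures using (IsAbelianGroup)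
open import Algebra.Bundles using (AbelianGroup)

module _ {A : Set} where

  Unique-resp-⊆ : {xs ys : List A} → xs ⊆ ys → Unique ys → Unique xs
  Unique-resp-⊆ [] u = u
  Unique-resp-⊆ (y ∷ʳ τ) (_ ∷ u) = Unique-resp-⊆ τ u
  Unique-resp-⊆ (refl ∷ τ) (px ∷ u) = All-resp-⊆ τ px ∷ Unique-resp-⊆ τ u

  unique∧set⇒↭ : {xs ys : List A} → Unique xs → Unique ys →
                 (∀ {v} → v ∈ xs ⇔ v ∈ ys) → xs ↭ ys
  unique∧set⇒↭ ux uy xs≈ys = ∼bag⇒↭ (unique∧set⇒bag ux uy xs≈ys)

  endpoints : List (A × A) → List A
  endpoints L = map proj₁ L ++ map proj₂ L

  Unique-sources : {L : List (A × A)} → Unique (endpoints L) → Unique (map proj₁ L)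
  Unique-sources = Unique-resp-⊆ (++⁺ʳ-⊆ _ ⊆-refl)

  Unique-targets : {L : List (A × A)} → Unique (endpoints L) → Unique (map proj₂ L)
  Unique-targets {L} = Unique-resp-⊆ (++⁺ˡ-⊆ (map proj₁ L) ⊆-refl)

  endpoints-⊆ : {xs ys : List (A × A)} → xs ⊆ ys → endpoints xs ⊆ endpoints ys
  endpoints-⊆ τ = ++⁺-⊆ (map⁺-⊆ proj₁ τ) (map⁺-⊆ proj₂ τ)

  endpoints-++ : ∀ xs ys → endpoints (xs ++ ys) ↭ endpoints xs ++ endpoints ys
  endpoints-++ xs ys = begin
    map proj₁ (xs ++ ys) ++ map proj₂ (xs ++ ys)  ≡⟨ cong₂ _++_ (map-++ proj₁ xs ys) (map-++ proj₂ xs ys) ⟩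
    (s xs ++ s ys) ++ (t xs ++ t ys)              ≡⟨ ++-assoc (s xs) (s ys) _ ⟩
    s xs ++ (s ys ++ t xs ++ t ys)                ↭⟨ ++⁺ˡ (s xs) (shifts (s ys) (t xs)) ⟩
    s xs ++ (t xs ++ s ys ++ t ys)                ≡⟨ sym (++-assoc (s xs) (t xs) _) ⟩
    endpoints xs ++ endpoints ys                  ∎
    where
    open PermutationReasoning
    s t : List (A × A) → List A
    s = map proj₁
    t = map proj₂

module _ {n : ℕ} (E : Graph n) where

  IsMatching-resp-⊆ : {xs ys : List (Fin n × Fin n)} → xs ⊆ ys → IsMatching E ys → IsMatching E xs
  IsMatching-resp-⊆ τ (arcs , unique) = All-resp-⊆ τ arcs , Unique-resp-⊆ (endpoints-⊆ τ) unique

  IsMatching-++ : {xs ys : List (Fin n × Fin n)} → IsMatching E xs → IsMatching E ys →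
                  (∀ {v} → v ∈ endpoints xs → v ∈ endpoints ys → ⊥) → IsMatching E (xs ++ ys)
  IsMatching-++ {xs} {ys} (arcsˣ , uniqueˣ) (arcsʸ , uniqueʸ) disjoint =
    All.++⁺ arcsˣ arcsʸ ,
    Permₛ.Unique-resp-↭ (setoid _) (↭⇒↭ₛ (↭-sym (endpoints-++ xs ys)))
      (Unique.++⁺ uniqueˣ uniqueʸ λ (v∈xs , v∈ys) → disjoint v∈xs v∈ys)

module Weights (W : OrderedAbelianGroup) where
  open OrderedAbelianGroup W
  open IsAbelianGroup isAbelianGroup
    using (assoc; identityˡ; identityʳ; inverseˡ; inverseʳ; isCommutativeMonoid)
  open ≡-Reasoning

  private
    group : AbelianGroup 0ℓ 0ℓ
    group = record { isAbelianGroup = isAbelianGroup }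

  open import Algebra.Properties.AbelianGroup group using (⁻¹-∙-comm)
  open import Algebra.Properties.CommutativeSemigroup (AbelianGroup.commutativeSemigroup group)
    using (interchange)

  total : List Carrier → Carrier
  total = foldr _+_ 0#

  total-↭ : {xs ys : List Carrier} → xs ↭ ys → total xs ≡ total ys
  total-↭ p = Permₛ.foldr-commMonoid (setoid Carrier) isCommutativeMonoid (↭⇒↭ₛ p)

  +-cancelʳ : ∀ x y → (x + y) - y ≡ x
  +-cancelʳ x y = begin
    (x + y) - y     ≡⟨ assoc x y (- y) ⟩
    x + (y - y)     ≡⟨ cong (x +_) (inverseʳ y) ⟩
    x + 0#          ≡⟨ identityʳ x ⟩
    x               ∎

  -‿interchange : ∀ x y u v → (x + y) - (u + v) ≡ (x - u) + (y - v)
  -‿interchange x y u v = begin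
    (x + y) - (u + v)          ≡⟨ cong ((x + y) +_) (sym (⁻¹-∙-comm u v)) ⟩
    (x + y) + ((- u) + (- v))  ≡⟨ interchange x y (- u) (- v) ⟩
    (x - u) + (y - v)          ∎

  x≤d+x⇒0≤d : ∀ {x d} → x ≤ (d + x) → 0# ≤ d
  x≤d+x⇒0≤d {x} {d} x≤d+x = subst₂ _≤_ (inverseʳ x) (+-cancelʳ d x) (+-monoˡ-≤ (- x) x≤d+x)

  0≤x-y⇒y≤x : ∀ {x y} → 0# ≤ (x - y) → y ≤ x
  0≤x-y⇒y≤x {x} {y} 0≤x-y = subst₂ _≤_ (identityˡ y) x-y+y≡x (+-monoˡ-≤ y 0≤x-y)
    where
    x-y+y≡x : (x - y) + y ≡ x
    x-y+y≡x = begin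
      (x - y) + y      ≡⟨ assoc x (- y) y ⟩
      x + ((- y) + y)  ≡⟨ cong (x +_) (inverseˡ y) ⟩
      x + 0#           ≡⟨ identityʳ x ⟩
      x                ∎

  0<x-y⇒y<x : ∀ {x y} → 0# < (x - y) → y < x
  0<x-y⇒y<x {x} (0≤x-y , 0≢x-y) = 0≤x-y⇒y≤x 0≤x-y , λ { refl → 0≢x-y (sym (inverseʳ x)) }

  module _ {n : ℕ} (f : Fin n → Carrier) where

    gain : Fin n × Fin n → Carrier
    gain (s , t) = f s - f t

    weight≡total-gain : ∀ L → weight W f L ≡ total (map gain L)
    weight≡total-gain [] = refl
    weight≡total-gain (p ∷ L) = cong (gain p +_) (weight≡total-gain L)

    weight-↭ : {xs ys : List (Fin n × Fin n)} → xs ↭ ys → weight W f xs ≡ weight W f ys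
    weight-↭ {xs} {ys} p = begin
      weight W f xs            ≡⟨ weight≡total-gain xs ⟩
      total (map gain xs)      ≡⟨ total-↭ (map⁺-↭ gain p) ⟩
      total (map gain ys)      ≡⟨ weight≡total-gain ys ⟨
      weight W f ys            ∎

    weight-++ : ∀ xs ys → weight W f (xs ++ ys) ≡ weight W f xs + weight W f ys
    weight-++ [] ys = sym (identityˡ _)
    weight-++ (p ∷ xs) ys = trans (cong (gain p +_) (weight-++ xs ys)) (sym (assoc _ _ _))

    weight≡sources-targets : ∀ L → weight W f L ≡ total (map f (map proj₁ L)) - total (map f (map proj₂ L))
    weight≡sources-targets [] = sym (inverseʳ 0#)
    weight≡sources-targets ((s , t) ∷ L) =
      trans (cong (gain (s , t) +_) (weight≡sources-targets L)) (sym (-‿interchange (f s) _ (f t) _))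

    weight-resp-endpoints : {L L′ : List (Fin n × Fin n)} →
      map proj₁ L ↭ map proj₁ L′ → map proj₂ L ↭ map proj₂ L′ → weight W f L ≡ weight W f L′
    weight-resp-endpoints {L} {L′} sources↭ targets↭ = begin
      weight W f L                                          ≡⟨ weight≡sources-targets L ⟩
      total (map f (map proj₁ L)) - total (map f (map proj₂ L))
        ≡⟨ cong₂ _-_ (total-↭ (map⁺-↭ f sources↭)) (total-↭ (map⁺-↭ f targets↭)) ⟩
      total (map f (map proj₁ L′)) - total (map f (map proj₂ L′)) ≡⟨ weight≡sources-targets L′ ⟨
      weight W f L′                                         ∎

  exchange-gain-positive : ∀ {n} {E : Graph n} {f : Fin n → Carrier} {M M′ d} →
    IsMaxWeightMinCard W E f M → IsMatching E M′ →
    weight W f M ≡ d + weight W f M′ → length M ≡ suc (length M′) → 0# < d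
  exchange-gain-positive {M′ = M′} (_ , maximal , minimal) matching′ M≡d+M′ |M|≡1+|M′| =
    x≤d+x⇒0≤d (subst (_ ≤_) M≡d+M′ (maximal _ matching′)) , 0≢d
    where
    0≢d : 0# ≢ _
    0≢d refl = ℕₚ.<-irrefl refl
      (subst (ℕ._≤ length M′) |M|≡1+|M′| (minimal _ matching′ (sym (trans M≡d+M′ (identityˡ _)))))

module Blocks {n k : ℕ} (σ : Fin n → Fin k) (M : List (Fin n × Fin n))
              (M-respects-σ : ∀ s t → (s , t) ∈ M → σ s ≡ σ t) where

  restrict : {Q : Pred (Fin k) 0ℓ} → Decidable Q → List (Fin n × Fin n)
  restrict Q? = filter (Q? ∘ σ ∘ proj₁) M

  restrict-⊆ : {Q : Pred (Fin k) 0ℓ} (Q? : Decidable Q) → restrict Q? ⊆ M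
  restrict-⊆ Q? = filter-⊆ (Q? ∘ σ ∘ proj₁) M

  ↭-restrict-++-restrict∁ : {Q : Pred (Fin k) 0ℓ} (Q? : Decidable Q) →
    M ↭ restrict Q? ++ restrict (∁? Q?)
  ↭-restrict-++-restrict∁ Q? =
    subst (λ parts → M ↭ proj₁ parts ++ proj₂ parts) (partition-defn P? M)
      (↭ₛ⇒↭ (Permₛ.partition-↭ (setoid _) P? M))
    where
    P? = Q? ∘ σ ∘ proj₁

  private
    ∈-map-restrict : {Q : Pred (Fin k) 0ℓ} (Q? : Decidable Q) (π : Fin n × Fin n → Fin n) →
      (∀ {p} → p ∈ M → σ (proj₁ p) ≡ σ (π p)) →
      ∀ {v} → v ∈ map π (restrict Q?) ⇔ (v ∈ map π M × Q (σ v))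
    ∈-map-restrict {Q} Q? π same-block = mk⇔ to from
      where
      to : ∀ {v} → v ∈ map π (restrict Q?) → v ∈ map π M × Q (σ v)
      to v∈ with ∈-map⁻ π v∈
      ... | p , p∈ , refl with ∈-filter⁻ (Q? ∘ σ ∘ proj₁) {xs = M} p∈
      ... | p∈M , Qp = ∈-map⁺ π p∈M , subst Q (same-block p∈M) Qp
      from : ∀ {v} → v ∈ map π M × Q (σ v) → v ∈ map π (restrict Q?)
      from (v∈ , Qv) with ∈-map⁻ π v∈
      ... | p , p∈M , refl =
        ∈-map⁺ π (∈-filter⁺ (Q? ∘ σ ∘ proj₁) p∈M (subst Q (sym (same-block p∈M)) Qv))

  ∈-sources-restrict : {Q : Pred (Fin k) 0ℓ} (Q? : Decidable Q) →
    ∀ {v} → v ∈ map proj₁ (restrict Q?) ⇔ (v ∈ map proj₁ M × Q (σ v))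
  ∈-sources-restrict Q? = ∈-map-restrict Q? proj₁ (λ _ → refl)

  ∈-targets-restrict : {Q : Pred (Fin k) 0ℓ} (Q? : Decidable Q) →
    ∀ {v} → v ∈ map proj₂ (restrict Q?) ⇔ (v ∈ map proj₂ M × Q (σ v))
  ∈-targets-restrict Q? = ∈-map-restrict Q? proj₂ (λ {(s , t)} → M-respects-σ s t)

  ∈-endpoints-restrict⁻ : {Q : Pred (Fin k) 0ℓ} (Q? : Decidable Q) →
    ∀ {v} → v ∈ endpoints (restrict Q?) → Q (σ v)
  ∈-endpoints-restrict⁻ Q? v∈ with ∈-++⁻ (map proj₁ (restrict Q?)) v∈
  ... | inj₁ v∈sources = proj₂ (Equivalence.to (∈-sources-restrict Q?) v∈sources)
  ... | inj₂ v∈targets = proj₂ (Equivalence.to (∈-targets-restrict Q?) v∈targets)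

module Exchange (W : OrderedAbelianGroup) {n : ℕ} (E : Graph n)
  (f : Fin n → OrderedAbelianGroup.Carrier W)
  {M : List (Fin n × Fin n)} (M-optimal : IsMaxWeightMinCard W E f M)
  {k : ℕ} (σ : Fin n → Fin k) (M-respects-σ : ∀ s t → (s , t) ∈ M → σ s ≡ σ t)
  (i : Fin k) (A : List (Fin n × Fin n)) (x y : Fin n) (B : List (Fin n × Fin n))
  (N-matching : IsMatching E (A ++ (x , y) ∷ B))
  (N-sources : ∀ v → v ∈ sources E (A ++ (x , y) ∷ B) ⇔ (v ∈ sources E M × σ v ≡ i))
  (N-targets : ∀ v → v ∈ targets E (A ++ (x , y) ∷ B) ⇔ (v ∈ targets E M × σ v ≡ i))
  where
  open OrderedAbelianGroup W
  open IsAbelianGroup isAbelianGroup using (assoc; comm)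
  open Weights W
  open Blocks σ M M-respects-σ

  N Mᵢ Mₒ M′ : List (Fin n × Fin n)
  N = A ++ (x , y) ∷ B
  Mᵢ = restrict (_≟ i)
  Mₒ = restrict (∁? (_≟ i))
  M′ = Mₒ ++ (A ++ B)

  private
    Mᵢ-matching : IsMatching E Mᵢ
    Mᵢ-matching = IsMatching-resp-⊆ E (restrict-⊆ (_≟ i)) (proj₁ M-optimal)

    sources-Mᵢ↭N : map proj₁ Mᵢ ↭ map proj₁ N
    sources-Mᵢ↭N = unique∧set⇒↭ (Unique-sources (proj₂ Mᵢ-matching)) (Unique-sources (proj₂ N-matching))
      (⇔-sym (N-sources _) ⇔-∘ ∈-sources-restrict (_≟ i))

    targets-Mᵢ↭N : map proj₂ Mᵢ ↭ map proj₂ N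
    targets-Mᵢ↭N = unique∧set⇒↭ (Unique-targets (proj₂ Mᵢ-matching)) (Unique-targets (proj₂ N-matching))
      (⇔-sym (N-targets _) ⇔-∘ ∈-targets-restrict (_≟ i))

    N↭xy∷A++B : N ↭ (x , y) ∷ A ++ B
    N↭xy∷A++B = shift (x , y) A B

    N-in-block-i : ∀ {v} → v ∈ endpoints N → σ v ≡ i
    N-in-block-i {v} v∈ with ∈-++⁻ (map proj₁ N) v∈
    ... | inj₁ v∈sources = proj₂ (Equivalence.to (N-sources v) v∈sources)
    ... | inj₂ v∈targets = proj₂ (Equivalence.to (N-targets v) v∈targets)

    A++B⊆N : A ++ B ⊆ N
    A++B⊆N = ++⁺-⊆ ⊆-refl ((x , y) ∷ʳ ⊆-refl)

  M′-matching : IsMatching E M′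
  M′-matching = IsMatching-++ E
    (IsMatching-resp-⊆ E (restrict-⊆ (∁? (_≟ i))) (proj₁ M-optimal))
    (IsMatching-resp-⊆ E A++B⊆N N-matching)
    (λ v∈Mₒ v∈A++B → ∈-endpoints-restrict⁻ (∁? (_≟ i)) v∈Mₒ
                        (N-in-block-i (Any-resp-⊆ (endpoints-⊆ A++B⊆N) v∈A++B)))

  weight-M : weight W f M ≡ gain f (x , y) + weight W f M′
  weight-M = begin
    weight W f M                                     ≡⟨ weight-↭ f (↭-restrict-++-restrict∁ (_≟ i)) ⟩
    weight W f (Mᵢ ++ Mₒ)                            ≡⟨ weight-++ f Mᵢ Mₒ ⟩
    weight W f Mᵢ + weight W f Mₒ                    ≡⟨ cong (_+ weight W f Mₒ) weight-Mᵢ ⟩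
    (gain f (x , y) + weight W f (A ++ B)) + weight W f Mₒ
                                                     ≡⟨ assoc _ _ _ ⟩
    gain f (x , y) + (weight W f (A ++ B) + weight W f Mₒ)
                                                     ≡⟨ cong (gain f (x , y) +_) (comm _ _) ⟩
    gain f (x , y) + (weight W f Mₒ + weight W f (A ++ B))
                                                     ≡⟨ cong (gain f (x , y) +_) (weight-++ f Mₒ (A ++ B)) ⟨
    gain f (x , y) + weight W f M′                   ∎
    where
    open ≡-Reasoning
    weight-Mᵢ : weight W f Mᵢ ≡ gain f (x , y) + weight W f (A ++ B)
    weight-Mᵢ = trans (weight-resp-endpoints f sources-Mᵢ↭N targets-Mᵢ↭N) (weight-↭ f N↭xy∷A++B)

  length-M : length M ≡ suc (length M′)
  length-M = begin
    length M                            ≡⟨ ↭-length (↭-restrict-++-restrict∁ (_≟ i)) ⟩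
    length (Mᵢ ++ Mₒ)                   ≡⟨ length-++ Mᵢ ⟩
    length Mᵢ ℕ.+ length Mₒ             ≡⟨ cong (ℕ._+ length Mₒ) length-Mᵢ ⟩
    suc (length (A ++ B) ℕ.+ length Mₒ) ≡⟨ cong suc (ℕₚ.+-comm (length (A ++ B)) _) ⟩
    suc (length Mₒ ℕ.+ length (A ++ B)) ≡⟨ cong suc (length-++ Mₒ) ⟨
    suc (length M′)                     ∎
    where
    open ≡-Reasoning
    length-Mᵢ : length Mᵢ ≡ suc (length (A ++ B))
    length-Mᵢ = begin
      length Mᵢ              ≡⟨ length-map proj₁ Mᵢ ⟨
      length (map proj₁ Mᵢ)  ≡⟨ ↭-length sources-Mᵢ↭N ⟩
      length (map proj₁ N)   ≡⟨ length-map proj₁ N ⟩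
      length N               ≡⟨ ↭-length N↭xy∷A++B ⟩
      suc (length (A ++ B))  ∎

lemma3p10 : (W : OrderedAbelianGroup) →
    let open OrderedAbelianGroup W in
    (n : ℕ) (E : Graph n) → IsDAG E →
    (f : Fin n → Carrier) →
    (M : List (Fin n × Fin n)) → IsMaxWeightMinCard W E f M →
    -- partitions (S_i) of S and (T_i) of T, given by a block label σ :
    -- S_i = { s ∈ S ∣ σ s ≡ i },  T_i = { t ∈ T ∣ σ t ≡ i }
    (k : ℕ) (σ : Fin n → Fin k) →
    -- M(S_i) = T_i for all i
    (∀ s t → (s , t) ∈ M → σ s ≡ σ t) →
    -- the vertex sets V(H(S_i,T_i)) are pairwise disjoint
    (∀ i j → i ≢ j → ∀ v s t s′ t′ →
       s ∈ sources E M → σ s ≡ i → t ∈ targets E M → σ t ≡ i →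
       s′ ∈ sources E M → σ s′ ≡ j → t′ ∈ targets E M → σ t′ ≡ j →
       ¬ (InH E s t v × InH E s′ t′ v)) →
    -- every comparable pair in S_i × T_i lies in some matching S_i → T_i
    (∀ i x y →
       x ∈ sources E M → σ x ≡ i → y ∈ targets E M → σ y ≡ i →
       _≺_ E x y →
       Σ (List (Fin n × Fin n)) λ N →
         IsMatching E N ×
         (∀ v → v ∈ sources E N ⇔ (v ∈ sources E M × σ v ≡ i)) ×
         (∀ v → v ∈ targets E N ⇔ (v ∈ targets E M × σ v ≡ i)) ×
         (x , y) ∈ N) →
    ∀ i x y →
    x ∈ sources E M → σ x ≡ i → y ∈ targets E M → σ y ≡ i →
    _≺_ E x y → f y < f x
lemma3p10 W n E _ f M M-optimal k σ M-respects-σ _ extends i x y x∈S σx y∈T σy x≺y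
  with extends i x y x∈S σx y∈T σy x≺y
... | N , N-matching , N-sources , N-targets , xy∈N with ∈-∃++ xy∈N
... | A , B , refl = 0<x-y⇒y<x (exchange-gain-positive M-optimal M′-matching weight-M length-M)
  where
  open Weights W
  open Exchange W E f M-optimal σ M-respects-σ i A x y B N-matching N-sources N-targets
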